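{- Let $K$ be any field, $n\ge 1$, and let $\det_n=\sum_{\sigma\in\Sigma_n}\operatorname{sgn}(\sigma)\, e_{\sigma(1)}\otimes\cdots\otimes e_{\sigma(n)}\in (K^n)^{\otimes n}$, where $e_1,\dots,e_n$ is the standard basis of $K^n$. Then $$\operatorname{brk}(\det_n)\le \operatorname{trk}(\det_n)\le \left(\tfrac{5}{6}\right)^{\lfloor n/3\rfloor} n!.$$
   Context: $\Sigma_n$ is the symmetric group on $n$ letters. For a tensor $T$ in $V_1\otimes\cdots\otimes V_n$ (finite-dimensional $K$-vector spaces), a simple tensor is one of the form $v_1\otimes\cdots\otimes v_n$; the tensor rank $\operatorname{trk}(T)$ is the least $r$ such that $T$ is a sum of $r$ simple tensors. Letting $\mathcal{S}_r$ denote the set of tensors of tensor rank $\le r$, the border rank $\operatorname{brk}(T)$ is the least $r$ such that $T$ lies in the Zariski closure of $\mathcal{S}_r$ in $V_1\otimes\cdots\otimes V_n$. -}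

module Defs where

open import Level using (Level; _⊔_) renaming (suc to lsuc)
open import Algebra.Bundles using (CommutativeRing)
open import Data.Nat using (ℕ; zero; suc; _<ᵇ_; _≡ᵇ_) renaming (_+_ to _+ℕ_)
open import Data.Fin using (Fin; toℕ) renaming (zero to fzero; suc to fsuc)
open import Data.Bool using (Bool; true; false; if_then_else_; _∧_)
open import Data.Product using (Σ)
open import Relation.Nullary using (¬_)

record Field (c ℓ : Level) : Set (lsuc (c ⊔ ℓ)) where
  field
    commutativeRing : CommutativeRing c ℓ
  open CommutativeRing commutativeRing public
  field
    0≉1     : ¬ (0# ≈ 1#)
    inverse : ∀ x → ¬ (x ≈ 0#) → Σ Carrier (λ y → (x * y) ≈ 1#)

sumℕ : ∀ {m} → (Fin m → ℕ) → ℕ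
sumℕ {zero}  f = 0
sumℕ {suc m} f = f fzero +ℕ sumℕ (λ j → f (fsuc j))

inversions : ∀ {n} → (Fin n → Fin n) → ℕ
inversions i = sumℕ λ j → sumℕ λ k →
  if (toℕ j <ᵇ toℕ k) ∧ (toℕ (i k) <ᵇ toℕ (i j)) then 1 else 0

-- number of pairs j < k with i j = i k ; i is a permutation iff this is 0
collisions : ∀ {n} → (Fin n → Fin n) → ℕ
collisions i = sumℕ λ j → sumℕ λ k →
  if (toℕ j <ᵇ toℕ k) ∧ (toℕ (i j) ≡ᵇ toℕ (i k)) then 1 else 0

module Tensors {c ℓ} (F : Field c ℓ) where
  open Field F

  ∑ : ∀ {m} → (Fin m → Carrier) → Carrier
  ∑ {zero}  f = 0#
  ∑ {suc m} f = f fzero + ∑ (λ j → f (fsuc j))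

  ∏ : ∀ {m} → (Fin m → Carrier) → Carrier
  ∏ {zero}  f = 1#
  ∏ {suc m} f = f fzero * ∏ (λ j → f (fsuc j))

  signK : ℕ → Carrier
  signK zero    = 1#
  signK (suc m) = - signK m

  -- A tensor in (K^n)^{⊗n}, given by its coordinates w.r.t. the basis
  -- e_{i 1} ⊗ ⋯ ⊗ e_{i n}, indexed by i : Fin n → Fin n.
  Tensor : ℕ → Set c
  Tensor n = (Fin n → Fin n) → Carrier

  simple : ∀ {n} → (Fin n → Fin n → Carrier) → Tensor n
  simple v i = ∏ λ j → v j (i j)

  TrkLE : ∀ {n} → Tensor n → ℕ → Set (c ⊔ ℓ)
  TrkLE {n} T r = Σ (Fin r → Fin n → Fin n → Carrier) λ vs →
    ∀ i → T i ≈ ∑ (λ k → simple (vs k) i)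

  data Poly (X : Set) : Set c where
    var  : X → Poly X
    con  : Carrier → Poly X
    _⊕_  : Poly X → Poly X → Poly X
    _⊛_  : Poly X → Poly X → Poly X

  eval : ∀ {X} → Poly X → (X → Carrier) → Carrier
  eval (var x)  a = a x
  eval (con k)  a = k
  eval (p ⊕ q)  a = eval p a + eval q a
  eval (p ⊛ q)  a = eval p a * eval q a

  -- brk(T) ≤ r : T lies in the Zariski closure of S_r, i.e. every polynomial
  -- function on (K^n)^{⊗n} vanishing on S_r vanishes at T.
  BrkLE : ∀ {n} → Tensor n → ℕ → Set (c ⊔ ℓ)
  BrkLE {n} T r = ∀ (p : Poly (Fin n → Fin n)) →
    (∀ S → TrkLE S r → eval p S ≈ 0#) → eval p T ≈ 0#

  -- det_n = Σ_{σ ∈ Σ_n} sgn(σ) e_{σ(1)} ⊗ ⋯ ⊗ e_{σ(n)}, coordinatewise: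
  -- coordinate sgn(σ) at σ if i = σ is a permutation, 0 otherwise.
  det : ∀ n → Tensor n
  det n i with collisions i ≡ᵇ 0
  ... | true  = signK (inversions i)
  ... | false = 0#

module Submission where

-- Writing e_{a₁} ∧ ⋯ ∧ e_{aₖ} for the antisymmetrised tensor of basis vectors, det_n = e₁ ∧ ⋯ ∧ e_n.
-- Laplace expansion along the first three tensor factors writes det_n as a signed sum, over columns
-- a < b < c, of (the 3 × 3 determinant on columns a, b, c) ⊗ (the wedge of the remaining n − 3 basis
-- vectors). That 3 × 3 determinant has tensor rank at most 5, one less than its six Leibniz terms, so
-- trk(det_n) ≤ 5 · C(n,3) · trk(det_{n−3}); since C(n,3) · 3! · (n−3)! = n!, induction gives
-- trk(det_n) ≤ (5/6)^⌊n/3⌋ n!. The minors produced by the expansion are wedges over a subset of the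
-- columns with signed weights, so the induction runs over all of those. Border rank is at most tensor
-- rank because S_r lies in its closure.

open import Defs
open import Algebra.Bundles using (CommutativeRing; RawRing)
open import Algebra.Solver.Ring.AlmostCommutativeRing using (fromCommutativeRing; _-Raw-AlmostCommutative⟶_)
open import Data.Bool using (Bool; true; false; if_then_else_; _∧_; not; T)
open import Data.Fin using (Fin; toℕ; splitAt) renaming (zero to fzero; suc to fsuc)
open import Data.Fin.Properties using (toℕ-injective)
open import Data.Fin.Patterns using (0F; 1F; 2F; 3F; 4F)
open import Data.Maybe using (Maybe; just; nothing)
open import Data.Nat as ℕ using (ℕ; zero; suc; _≡ᵇ_; _<ᵇ_)
open import Data.Nat.Combinatorics using (_C_; nC1≡n)
import Data.Nat.Properties as ℕ
open import Data.Product using (Σ; _×_; _,_)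
open import Data.Sum using (inj₁; inj₂)
open import Data.Vec.Functional using (Vector; head; tail; _++_; _∷_; [])
open import Function using (_∘′_; id)
open import Level using (0ℓ; _⊔_)
import Relation.Binary.PropositionalEquality as ≡
open ≡ using (_≡_; refl)
open import Relation.Nullary using (yes; no)

module Counting where
  open import Data.Nat
  open import Data.Nat.Combinatorics using (nCk+nC[k+1]≡[n+1]C[k+1])
  open import Algebra.Properties.CommutativeSemigroup ℕ.+-commutativeSemigroup using (x∙yz≈y∙xz)

  sumℕ-cong : ∀ {m} {f g : Fin m → ℕ} → (∀ j → f j ≡ g j) → sumℕ f ≡ sumℕ g
  sumℕ-cong {zero}  f≡g = refl
  sumℕ-cong {suc m} f≡g = ≡.cong₂ _+_ (f≡g fzero) (sumℕ-cong λ j → f≡g (fsuc j))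

  count : ∀ {N} → (Fin N → Bool) → ℕ
  count m = sumℕ λ v → if m v then 1 else 0

  remove : ∀ {N} → Fin N → (Fin N → Bool) → Fin N → Bool
  remove a m v = not (toℕ a ≡ᵇ toℕ v) ∧ m v

  above : ∀ {N} → Fin N → (Fin N → Bool) → Fin N → Bool
  above a m v = (toℕ a <ᵇ toℕ v) ∧ m v

  remove₃ : ∀ {N} → Fin N → Fin N → Fin N → (Fin N → Bool) → Fin N → Bool
  remove₃ a b c m = remove c (remove b (remove a m))

  count-remove : ∀ {N} (a : Fin N) (m : Fin N → Bool) →
    count m ≡ (if m a then 1 else 0) + count (remove a m)
  count-remove fzero    m = refl
  count-remove (fsuc a) m = ≡.trans (≡.cong ((if m fzero then 1 else 0) +_) (count-remove a (m ∘′ fsuc)))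
                                  (x∙yz≈y∙xz (if m fzero then 1 else 0) (if m (fsuc a) then 1 else 0) _)

  count-remove-member : ∀ {N n} (a : Fin N) (m : Fin N → Bool) →
    m a ≡ true → count m ≡ suc n → count (remove a m) ≡ n
  count-remove-member a m ma≡true count≡1+n with count-remove a m
  ... | count≡ rewrite ma≡true = ℕ.suc-injective (≡.trans (≡.sym count≡) count≡1+n)

  <ᵇ⇒≢ᵇ : ∀ X Y → (X <ᵇ Y) ≡ true → not (X ≡ᵇ Y) ≡ true
  <ᵇ⇒≢ᵇ zero    (suc Y) _   = refl
  <ᵇ⇒≢ᵇ (suc X) (suc Y) X<Y = <ᵇ⇒≢ᵇ X Y X<Y

  ∧-mono : ∀ {p p′ q q′} → (p ≡ true → p′ ≡ true) → (q ≡ true → q′ ≡ true) → p ∧ q ≡ true → p′ ∧ q′ ≡ true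
  ∧-mono {true} {q = true} p⇒p′ q⇒q′ _ rewrite p⇒p′ refl = q⇒q′ refl

  above⇒remove : ∀ {N} (a : Fin N) m v → above a m v ≡ true → remove a m v ≡ true
  above⇒remove a m v = ∧-mono (<ᵇ⇒≢ᵇ (toℕ a) (toℕ v)) id

  count-remove₃ : ∀ {N n} (a b c : Fin N) (m : Fin N → Bool) →
    m a ≡ true → above a m b ≡ true → above b (above a m) c ≡ true → count m ≡ 3 + n →
    count (remove₃ a b c m) ≡ n
  count-remove₃ a b c m a∈ b∈ c∈ count≡ =
    count-remove-member c _ (∧-mono (<ᵇ⇒≢ᵇ (toℕ b) (toℕ c)) (above⇒remove a m c) c∈)
      (count-remove-member b _ (above⇒remove a m b b∈) (count-remove-member a m a∈ count≡))

  count-all : ∀ N → count {N} (λ _ → true) ≡ N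
  count-all zero    = refl
  count-all (suc N) = ≡.cong suc (count-all N)

  sumIncreasing : ℕ → ∀ {N} → (Fin N → Bool) → ℕ → ℕ
  sumIncreasing zero    m w = w
  sumIncreasing (suc k) m w = sumℕ λ a → if m a then sumIncreasing k (above a m) w else 0

  sumIncreasing-tail : ∀ k {N} (m : Fin (suc N) → Bool) w →
    m fzero ≡ false → sumIncreasing k m w ≡ sumIncreasing k (m ∘′ fsuc) w
  sumIncreasing-tailTerms : ∀ k {N} (m : Fin (suc N) → Bool) w →
    sumℕ (λ a → if m (fsuc a) then sumIncreasing k (above (fsuc a) m) w else 0)
      ≡ sumIncreasing (suc k) (m ∘′ fsuc) w

  sumIncreasing-tail zero    m w _ = refl
  sumIncreasing-tail (suc k) m w m0≡false rewrite m0≡false = sumIncreasing-tailTerms k m w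

  sumIncreasing-tailTerms k m w = sumℕ-cong λ a →
    ≡.cong (if m (fsuc a) then_else 0) (sumIncreasing-tail k (above (fsuc a) m) w refl)

  sumIncreasing≡C : ∀ k {N} (m : Fin N → Bool) w → sumIncreasing k m w ≡ (count m C k) * w
  sumIncreasing≡C zero    m w = ≡.sym (ℕ.+-identityʳ w)
  sumIncreasing≡C (suc k) {zero}  m w = refl
  sumIncreasing≡C (suc k) {suc N} m w with m fzero in m0
  ... | true  = begin
    sumIncreasing k (above fzero m) w + _      ≡⟨ ≡.cong₂ _+_ first (rest k) ⟩
    (c C k) * w + (c C suc k) * w                 ≡⟨ ℕ.*-distribʳ-+ w (c C k) (c C suc k) ⟨
    (c C k + c C suc k) * w                   ≡⟨ ≡.cong (_* w) (nCk+nC[k+1]≡[n+1]C[k+1] c k) ⟩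
    (suc c C suc k) * w                      ∎
    where
    open ≡.≡-Reasoning
    c = count (m ∘′ fsuc)
    first : sumIncreasing k (above fzero m) w ≡ (c C k) * w
    first = ≡.trans (sumIncreasing-tail k (above fzero m) w refl) (sumIncreasing≡C k (m ∘′ fsuc) w)
    rest : ∀ j → _ ≡ (c C suc j) * w
    rest j = ≡.trans (sumIncreasing-tailTerms j m w) (sumIncreasing≡C (suc j) (m ∘′ fsuc) w)
  ... | false = ≡.trans (sumIncreasing-tailTerms k m w) (sumIncreasing≡C (suc k) (m ∘′ fsuc) w)

open Counting

module RankBound where
  open import Data.Nat
  open import Data.Nat.Properties using (_!*_!≢0)
  open import Data.Nat.Combinatorics using (nCk≡n!/k![n-k]!; k![n∸k]!∣n!)
  open import Data.Nat.DivMod using (m/n*n≡m; m/n≡1+[m∸n]/n)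
  open import Data.Nat.Tactic.RingSolver using (solve-∀)

  detRankBound : ℕ → ℕ
  detRankBound 0 = 1
  detRankBound 1 = 1
  detRankBound 2 = 2
  detRankBound (suc (suc (suc n))) = ((3 + n) C 3) * (5 * detRankBound n)

  [3+n]C3*3!*n!≡[3+n]! : ∀ n → ((3 + n) C 3) * (6 * n !) ≡ (3 + n) !
  [3+n]C3*3!*n!≡[3+n]! n = ≡.trans (≡.cong (_* (6 * n !)) (nCk≡n!/k![n-k]! 3≤3+n)) (m/n*n≡m (k![n∸k]!∣n! 3≤3+n))
    where
    instance _ = 3 !* n !≢0
    3≤3+n : 3 ≤ 3 + n
    3≤3+n = s≤s (s≤s (s≤s z≤n))

  6^[n/3]*detRankBound≤5^[n/3]*n! : ∀ n → 6 ^ (n / 3) * detRankBound n ≤ 5 ^ (n / 3) * n !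
  6^[n/3]*detRankBound≤5^[n/3]*n! 0 = ℕ.≤-refl
  6^[n/3]*detRankBound≤5^[n/3]*n! 1 = ℕ.≤-refl
  6^[n/3]*detRankBound≤5^[n/3]*n! 2 = ℕ.≤-refl
  6^[n/3]*detRankBound≤5^[n/3]*n! (suc (suc (suc n))) rewrite m/n≡1+[m∸n]/n {3 + n} {3} (s≤s (s≤s (s≤s z≤n))) = begin
    6 ^ suc q * (c * (5 * detRankBound n))  ≡⟨ regroupˡ (6 ^ q) (detRankBound n) c ⟩
    (5 * c * 6) * (6 ^ q * detRankBound n)  ≤⟨ ℕ.*-monoʳ-≤ (5 * c * 6) (6^[n/3]*detRankBound≤5^[n/3]*n! n) ⟩
    (5 * c * 6) * (5 ^ q * n !)             ≡⟨ regroupʳ (5 ^ q) (n !) c ⟩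
    5 ^ suc q * (c * (6 * n !))             ≡⟨ ≡.cong (5 ^ suc q *_) ([3+n]C3*3!*n!≡[3+n]! n) ⟩
    5 ^ suc q * (3 + n) !                    ∎
    where
    open ℕ.≤-Reasoning
    q = n / 3
    c = (3 + n) C 3
    regroupˡ : ∀ x r c → (6 * x) * (c * (5 * r)) ≡ (5 * c * 6) * (x * r)
    regroupˡ = solve-∀
    regroupʳ : ∀ x f c → (5 * c * 6) * (x * f) ≡ (5 * x) * (c * (6 * f))
    regroupʳ = solve-∀

open RankBound

-- Tactic.RingSolver takes the carrier itself as coefficient ring and cannot cancel 1 + (- 1) without a
-- decidable zero test, so we instantiate Algebra.Solver.Ring with integer coefficients, given as
-- differences (p , q) ↦ p − q of naturals.
module IntegerCoefficientSolver {c ℓ} (R : CommutativeRing c ℓ) where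
  open CommutativeRing R renaming (refl to ≈-refl)
  open import Algebra.Properties.Semiring.Mult semiring using (×-homo-+; ×1-homo-*)
    renaming (_×_ to _·_)
  open import Algebra.Properties.Ring ring using (-‿distribˡ-*; -‿distribʳ-*; -‿involutive; -‿anti-homo-+; -‿+-comm; -0#≈0#)
  open import Algebra.Properties.CommutativeSemigroup +-commutativeSemigroup using () renaming (interchange to +-interchange)
  open import Relation.Binary.Reasoning.Setoid setoid

  differences : RawRing 0ℓ 0ℓ
  differences = record
    { Carrier = ℕ × ℕ
    ; _≈_ = _≡_
    ; _+_ = λ { (a , b) (c , d) → a ℕ.+ c , b ℕ.+ d }
    ; _*_ = λ { (a , b) (c , d) → a ℕ.* c ℕ.+ b ℕ.* d , a ℕ.* d ℕ.+ b ℕ.* c }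
    ; -_ = λ { (a , b) → b , a }
    ; 0# = 0 , 0
    ; 1# = 1 , 0
    }

  ⟦_⟧ : ℕ × ℕ → Carrier
  ⟦ p , q ⟧ = p · 1# - q · 1#

  sub-+ : ∀ a b c d → (a + c) - (b + d) ≈ (a - b) + (c - d)
  sub-+ a b c d = trans (+-congˡ (sym (-‿+-comm b d))) (+-interchange a c (- b) (- d))

  sub-* : ∀ a b c d → (a * c + b * d) - (a * d + b * c) ≈ (a - b) * (c - d)
  sub-* a b c d = sym (begin
    (a - b) * (c - d)                           ≈⟨ distribʳ (c - d) a (- b) ⟩
    a * (c - d) + - b * (c - d)                 ≈⟨ +-cong (distribˡ a c (- d)) (distribˡ (- b) c (- d)) ⟩
    (a * c + a * - d) + (- b * c + - b * - d)   ≈⟨ +-cong (+-congˡ (sym (-‿distribʳ-* a d))) (+-cong (sym (-‿distribˡ-* b c)) neg*neg) ⟩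
    (a * c - a * d) + (- (b * c) + b * d)       ≈⟨ +-congˡ (+-comm (- (b * c)) (b * d)) ⟩
    (a * c - a * d) + (b * d - b * c)           ≈⟨ +-interchange (a * c) (- (a * d)) (b * d) (- (b * c)) ⟩
    (a * c + b * d) + (- (a * d) - b * c)       ≈⟨ +-congˡ (-‿+-comm (a * d) (b * c)) ⟩
    (a * c + b * d) - (a * d + b * c)           ∎)
    where
    neg*neg : - b * - d ≈ b * d
    neg*neg = trans (sym (-‿distribˡ-* b (- d))) (trans (-‿cong (sym (-‿distribʳ-* b d))) (-‿involutive (b * d)))

  sub-cancelʳ : ∀ a b z → (a + z) - (b + z) ≈ a - b
  sub-cancelʳ a b z = begin
    (a + z) - (b + z)   ≈⟨ sub-+ a b z z ⟩
    (a - b) + (z - z)   ≈⟨ +-congˡ (-‿inverseʳ z) ⟩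
    (a - b) + 0#        ≈⟨ +-identityʳ _ ⟩
    a - b               ∎

  ·1-homo-+ : ∀ m n → (m ℕ.+ n) · 1# ≈ m · 1# + n · 1#
  ·1-homo-+ = ×-homo-+ 1#

  homomorphism : differences -Raw-AlmostCommutative⟶ fromCommutativeRing R
  homomorphism = record
    { ⟦_⟧    = ⟦_⟧
    ; +-homo = λ { (a , b) (c , d) → trans (+-cong (·1-homo-+ a c) (-‿cong (·1-homo-+ b d))) (sub-+ _ _ _ _) }
    ; *-homo = λ { (a , b) (c , d) → trans (+-cong (·1-homo-*+* a c b d) (-‿cong (·1-homo-*+* a d b c))) (sub-* _ _ _ _) }
    ; -‿homo = λ { (a , b) → sym (trans (-‿anti-homo-+ (a · 1#) (- (b · 1#))) (+-congʳ (-‿involutive (b · 1#)))) }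
    ; 0-homo = -‿inverseʳ 0#
    ; 1-homo = trans (+-cong (+-identityʳ 1#) -0#≈0#) (+-identityʳ 1#)
    }
    where
    ·1-homo-*+* : ∀ a c b d → (a ℕ.* c ℕ.+ b ℕ.* d) · 1# ≈ (a · 1#) * (c · 1#) + (b · 1#) * (d · 1#)
    ·1-homo-*+* a c b d = trans (·1-homo-+ (a ℕ.* c) (b ℕ.* d)) (+-cong (×1-homo-* a c) (×1-homo-* b d))

  equal? : ∀ x y → Maybe (⟦ x ⟧ ≈ ⟦ y ⟧)
  equal? (a , b) (c , d) with a ℕ.+ d ℕ.≟ c ℕ.+ b
  ... | no  _ = nothing
  ... | yes e = just (begin
    a · 1# - b · 1#                         ≈⟨ sub-cancelʳ (a · 1#) (b · 1#) (d · 1#) ⟨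
    (a · 1# + d · 1#) - (b · 1# + d · 1#)   ≈⟨ +-cong (·1-homo-+ a d) (-‿cong (·1-homo-+ b d)) ⟨
    (a ℕ.+ d) · 1# - (b ℕ.+ d) · 1#         ≈⟨ reflexive (≡.cong₂ (λ u v → u · 1# - v · 1#) e (ℕ.+-comm b d)) ⟩
    (c ℕ.+ b) · 1# - (d ℕ.+ b) · 1#         ≈⟨ +-cong (·1-homo-+ c b) (-‿cong (·1-homo-+ d b)) ⟩
    (c · 1# + b · 1#) - (d · 1# + b · 1#)   ≈⟨ sub-cancelʳ (c · 1#) (d · 1#) (b · 1#) ⟩
    c · 1# - d · 1#                         ∎)

  open import Algebra.Solver.Ring differences (fromCommutativeRing R) homomorphism equal?
    using (solve; _:=_; _:+_; _:*_; :-_; _:-_) public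

module Wedge {c ℓ} (F : Field c ℓ) where
  open Field F renaming (refl to ≈-refl)
  open Tensors F
  open import Algebra.Properties.Ring ring using (-‿distribˡ-*; -‿+-comm; -0#≈0#)
  open import Algebra.Properties.CommutativeSemigroup +-commutativeSemigroup using () renaming (interchange to +-interchange)
  open import Algebra.Properties.CommutativeSemigroup *-commutativeSemigroup using ()
    renaming (interchange to *-interchange; xy∙z≈xz∙y to xy*z≈xz*y)
  open import Relation.Binary.Reasoning.Setoid setoid
  open IntegerCoefficientSolver commutativeRing using (solve; _:=_; _:+_; _:*_; :-_; _:-_)

  𝟙 : Bool → Carrier
  𝟙 true  = 1#
  𝟙 false = 0#

  𝟙-∧ : ∀ a b → 𝟙 (a ∧ b) ≈ 𝟙 a * 𝟙 b
  𝟙-∧ true  b = sym (*-identityˡ _)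
  𝟙-∧ false b = sym (zeroˡ _)

  if≈𝟙* : ∀ b (x : Carrier) → (if b then x else 0#) ≈ 𝟙 b * x
  if≈𝟙* true  x = sym (*-identityˡ x)
  if≈𝟙* false x = sym (zeroˡ x)

  δ : ∀ {N} → Fin N → Fin N → Carrier
  δ x a = 𝟙 (toℕ x ≡ᵇ toℕ a)

  ∑-cong : ∀ {m} {f g : Fin m → Carrier} → (∀ j → f j ≈ g j) → ∑ f ≈ ∑ g
  ∑-cong {zero}  f≈g = ≈-refl
  ∑-cong {suc m} f≈g = +-cong (f≈g fzero) (∑-cong λ j → f≈g (fsuc j))

  ∏-cong : ∀ {m} {f g : Fin m → Carrier} → (∀ j → f j ≈ g j) → ∏ f ≈ ∏ g
  ∏-cong {zero}  f≈g = ≈-refl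
  ∏-cong {suc m} f≈g = *-cong (f≈g fzero) (∏-cong λ j → f≈g (fsuc j))

  ∑-0 : ∀ {m} {f : Fin m → Carrier} → (∀ j → f j ≈ 0#) → ∑ f ≈ 0#
  ∑-0 {zero}  f≈0 = ≈-refl
  ∑-0 {suc m} f≈0 = trans (+-cong (f≈0 fzero) (∑-0 λ j → f≈0 (fsuc j))) (+-identityʳ 0#)

  *-distribˡ-∑ : ∀ {m} x (f : Fin m → Carrier) → x * ∑ f ≈ ∑ λ j → x * f j
  *-distribˡ-∑ {zero}  x f = zeroʳ x
  *-distribˡ-∑ {suc m} x f = trans (distribˡ x _ _) (+-congˡ (*-distribˡ-∑ x (tail f)))

  *-distribʳ-∑ : ∀ {m} x (f : Fin m → Carrier) → ∑ f * x ≈ ∑ λ j → f j * x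
  *-distribʳ-∑ {zero}  x f = zeroˡ x
  *-distribʳ-∑ {suc m} x f = trans (distribʳ x _ _) (+-congˡ (*-distribʳ-∑ x (tail f)))

  ∑-distrib-+ : ∀ {m} (f g : Fin m → Carrier) → ∑ (λ j → f j + g j) ≈ ∑ f + ∑ g
  ∑-distrib-+ {zero}  f g = sym (+-identityʳ 0#)
  ∑-distrib-+ {suc m} f g = trans (+-congˡ (∑-distrib-+ (tail f) (tail g))) (+-interchange _ _ _ _)

  ∑-distrib-- : ∀ {m} (f : Fin m → Carrier) → ∑ (λ j → - f j) ≈ - ∑ f
  ∑-distrib-- {zero}  f = sym -0#≈0#
  ∑-distrib-- {suc m} f = trans (+-congˡ (∑-distrib-- (tail f))) (-‿+-comm _ _)

  ∑-++ : ∀ {a} {A : Set a} {r s} (h : A → Carrier) (f : Vector A r) (g : Vector A s) →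
    ∑ (λ k → h ((f ++ g) k)) ≈ ∑ (λ k → h (f k)) + ∑ (λ k → h (g k))
  ∑-++ {r = zero}  h f g = sym (+-identityˡ _)
  ∑-++ {r = suc r} h f g = trans (+-congˡ (trans (∑-cong tail-++) (∑-++ h (tail f) g))) (sym (+-assoc _ _ _))
    where
    tail-++ : ∀ k → h ((f ++ g) (fsuc k)) ≈ h ((tail f ++ g) k)
    tail-++ k with splitAt r k
    ... | inj₁ _ = ≈-refl
    ... | inj₂ _ = ≈-refl

  ∏-distrib-* : ∀ {m} (f g : Fin m → Carrier) → ∏ (λ j → f j * g j) ≈ ∏ f * ∏ g
  ∏-distrib-* {zero}  f g = sym (*-identityˡ 1#)
  ∏-distrib-* {suc m} f g = trans (*-congˡ (∏-distrib-* (tail f) (tail g))) (*-interchange _ _ _ _)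

  ∏-1 : ∀ m → ∏ {m} (λ _ → 1#) ≈ 1#
  ∏-1 zero    = ≈-refl
  ∏-1 (suc m) = trans (*-identityˡ _) (∏-1 m)

  ∑-δ : ∀ {N} (x : Fin N) (f : Fin N → Carrier) → ∑ (λ a → δ x a * f a) ≈ f x
  ∑-δ fzero    f = trans (+-cong (*-identityˡ _) (∑-0 λ a → zeroˡ (f (fsuc a)))) (+-identityʳ _)
  ∑-δ (fsuc x) f = trans (+-cong (zeroˡ _) (∑-δ x (tail f))) (+-identityˡ _)

  -- For N = n this is TrkLE; the generalisation lets words take values in any Fin N.
  RankLE : ∀ {n N} → (Vector (Fin N) n → Carrier) → ℕ → Set (c ⊔ ℓ)
  RankLE {n} {N} T r = Σ (Fin r → Fin n → Fin N → Carrier) λ vs →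
    ∀ i → T i ≈ ∑ λ k → ∏ λ j → vs k j (i j)

  RankLE-cong : ∀ {n N} {T T′ : Vector (Fin N) n → Carrier} {r} →
    (∀ i → T i ≈ T′ i) → RankLE T r → RankLE T′ r
  RankLE-cong T≈T′ (vs , T≈) = vs , λ i → trans (sym (T≈T′ i)) (T≈ i)

  RankLE-0 : ∀ {n N} → RankLE {n} {N} (λ _ → 0#) 0
  RankLE-0 = (λ ()) , λ _ → ≈-refl

  RankLE-+ : ∀ {n N} {T T′ : Vector (Fin N) n → Carrier} {r r′} →
    RankLE T r → RankLE T′ r′ → RankLE (λ i → T i + T′ i) (r ℕ.+ r′)
  RankLE-+ (vs , T≈) (vs′ , T′≈) = vs ++ vs′ , λ i →
    trans (+-cong (T≈ i) (T′≈ i)) (sym (∑-++ (λ v → ∏ λ j → v j (i j)) vs vs′))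

  RankLE-∑ : ∀ {n N M} {T : Fin M → Vector (Fin N) n → Carrier} {r : Fin M → ℕ} →
    (∀ a → RankLE (T a) (r a)) → RankLE (λ i → ∑ λ a → T a i) (sumℕ r)
  RankLE-∑ {M = zero}  rk = RankLE-0
  RankLE-∑ {M = suc M} rk = RankLE-+ (rk fzero) (RankLE-∑ λ a → rk (fsuc a))

  RankLE-if : ∀ {n N} {T : Vector (Fin N) n → Carrier} {r} b →
    (b ≡ true → RankLE T r) → RankLE (λ i → if b then T i else 0#) (if b then r else 0)
  RankLE-if true  rk = rk refl
  RankLE-if false rk = RankLE-0

  RankLE-⊗ : ∀ {n N} {T : Vector (Fin N) n → Carrier} {r} (u : Fin N → Carrier) →
    RankLE T r → RankLE {suc n} (λ i → u (head i) * T (tail i)) r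
  RankLE-⊗ {r = r} u (vs , T≈) = (λ k → u ∷ vs k) , λ i →
    trans (*-congˡ (T≈ (tail i))) (*-distribˡ-∑ (u (head i)) λ k → ∏ λ j → vs k j (i (fsuc j)))

  𝟙[+≡ᵇ0] : ∀ a b → 𝟙 ((a ℕ.+ b) ≡ᵇ 0) ≈ 𝟙 (a ≡ᵇ 0) * 𝟙 (b ≡ᵇ 0)
  𝟙[+≡ᵇ0] zero    b = sym (*-identityˡ _)
  𝟙[+≡ᵇ0] (suc a) b = sym (zeroˡ _)

  𝟙[sumℕ≡ᵇ0] : ∀ {m} (f : Fin m → ℕ) → 𝟙 (sumℕ f ≡ᵇ 0) ≈ ∏ λ k → 𝟙 (f k ≡ᵇ 0)
  𝟙[sumℕ≡ᵇ0] {zero}  f = ≈-refl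
  𝟙[sumℕ≡ᵇ0] {suc m} f = trans (𝟙[+≡ᵇ0] (f fzero) _) (*-congˡ (𝟙[sumℕ≡ᵇ0] (tail f)))

  signK-+ : ∀ a b → signK (a ℕ.+ b) ≈ signK a * signK b
  signK-+ zero    b = sym (*-identityˡ _)
  signK-+ (suc a) b = trans (-‿cong (signK-+ a b)) (-‿distribˡ-* _ _)

  signK-sumℕ : ∀ {m} (f : Fin m → ℕ) → signK (sumℕ f) ≈ ∏ λ k → signK (f k)
  signK-sumℕ {zero}  f = ≈-refl
  signK-sumℕ {suc m} f = trans (signK-+ (f fzero) _) (*-congˡ (signK-sumℕ (tail f)))

  collisionsOf : ∀ {n N} → Vector (Fin N) n → ℕ
  collisionsOf i = sumℕ λ j → sumℕ λ k →
    if (toℕ j <ᵇ toℕ k) ∧ (toℕ (i j) ≡ᵇ toℕ (i k)) then 1 else 0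

  inversionsOf : ∀ {n N} → Vector (Fin N) n → ℕ
  inversionsOf i = sumℕ λ j → sumℕ λ k →
    if (toℕ j <ᵇ toℕ k) ∧ (toℕ (i k) <ᵇ toℕ (i j)) then 1 else 0

  sgn : ∀ {n N} → Vector (Fin N) n → Carrier
  sgn i = 𝟙 (collisionsOf i ≡ᵇ 0) * signK (inversionsOf i)

  pairSign : ∀ {N} → Fin N → Fin N → Carrier
  pairSign x v = 𝟙 ((if toℕ x ≡ᵇ toℕ v then 1 else 0) ≡ᵇ 0) * signK (if toℕ v <ᵇ toℕ x then 1 else 0)

  sgn-cons : ∀ {n N} (i : Vector (Fin N) (suc n)) →
    sgn i ≈ (∏ λ k → pairSign (head i) (tail i k)) * sgn (tail i)
  sgn-cons i = begin
    𝟙 ((p₀ ℕ.+ p) ≡ᵇ 0) * signK (v₀ ℕ.+ v)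
      ≈⟨ *-cong (𝟙[+≡ᵇ0] p₀ p) (signK-+ v₀ v) ⟩
    (𝟙 (p₀ ≡ᵇ 0) * 𝟙 (p ≡ᵇ 0)) * (signK v₀ * signK v)
      ≈⟨ *-interchange _ _ _ _ ⟩
    (𝟙 (p₀ ≡ᵇ 0) * signK v₀) * sgn (tail i)
      ≈⟨ *-congʳ (*-cong (𝟙[sumℕ≡ᵇ0] meets) (signK-sumℕ below)) ⟩
    ((∏ λ k → 𝟙 (meets k ≡ᵇ 0)) * ∏ (signK ∘′ below)) * sgn (tail i)
      ≈⟨ *-congʳ (∏-distrib-* (λ k → 𝟙 (meets k ≡ᵇ 0)) (signK ∘′ below)) ⟨
    (∏ λ k → pairSign (head i) (tail i k)) * sgn (tail i) ∎
    where
    meets below : Fin _ → ℕ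
    meets k = if toℕ (head i) ≡ᵇ toℕ (tail i k) then 1 else 0
    below k = if toℕ (tail i k) <ᵇ toℕ (head i) then 1 else 0
    p₀ = sumℕ meets
    p  = collisionsOf (tail i)
    v₀ = sumℕ below
    v  = inversionsOf (tail i)

  restrict : ∀ {N} → (Fin N → Bool) → (Fin N → Carrier) → Fin N → Carrier
  restrict m d v = if m v then d v else 0#

  signedBy : ∀ {N} → (Fin N → Carrier) → Fin N → Fin N → Carrier
  signedBy d x v = d v * pairSign x v

  -- For m = {a₁ < ⋯ < aₙ}, wedge m d is (∏ₖ d aₖ) · e_{a₁} ∧ ⋯ ∧ e_{aₙ}; det n is the case m = all, d = 1.
  wedge : ∀ {n N} → (Fin N → Bool) → (Fin N → Carrier) → Vector (Fin N) n → Carrier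
  wedge m d i = (∏ λ j → restrict m d (i j)) * sgn i

  restrict-signedBy : ∀ {N} (m : Fin N → Bool) d x v →
    restrict m (signedBy d x) v ≈ restrict m d v * pairSign x v
  restrict-signedBy m d x v with m v
  ... | true  = ≈-refl
  ... | false = sym (zeroˡ _)

  pairSign-self : ∀ {N} (x : Fin N) → pairSign x x ≈ 0#
  pairSign-self x with toℕ x ≡ᵇ toℕ x | ℕ.≡⇒≡ᵇ (toℕ x) (toℕ x) refl
  ... | true | _ = zeroˡ _

  restrict-remove : ∀ {N} (a : Fin N) m d → d a ≈ 0# → ∀ v → restrict (remove a m) d v ≈ restrict m d v
  restrict-remove a m d da≈0 v with toℕ a ≡ᵇ toℕ v in a≟v | m v
  ... | false | _     = ≈-refl
  ... | true  | false = ≈-refl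
  ... | true  | true  = sym (trans (reflexive (≡.cong d (≡.sym a≡v))) da≈0)
    where
    a≡v : a ≡ v
    a≡v = toℕ-injective (ℕ.≡ᵇ⇒≡ (toℕ a) (toℕ v) (≡.subst T (≡.sym a≟v) _))

  signedBy-self : ∀ {N} (d : Fin N → Carrier) x → signedBy d x x ≈ 0#
  signedBy-self d x = trans (*-congˡ (pairSign-self x)) (zeroʳ _)

  signedBy-vanishes : ∀ {N} (d : Fin N → Carrier) x {v} → d v ≈ 0# → signedBy d x v ≈ 0#
  signedBy-vanishes d x dv≈0 = trans (*-congʳ dv≈0) (zeroˡ _)

  restrict-remove-signedBy : ∀ {N} (a : Fin N) m d v →
    restrict (remove a m) (signedBy d a) v ≈ restrict m (signedBy d a) v
  restrict-remove-signedBy a m d = restrict-remove a m (signedBy d a) (signedBy-self d a)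

  wedge-cong : ∀ {n N} {m m′ : Fin N → Bool} {d d′} → (∀ v → restrict m d v ≈ restrict m′ d′ v) →
    ∀ (i : Vector (Fin N) n) → wedge m d i ≈ wedge m′ d′ i
  wedge-cong restrict≈ i = *-congʳ (∏-cong λ j → restrict≈ (i j))

  wedge-cons : ∀ {n N} (m : Fin N → Bool) d (i : Vector (Fin N) (suc n)) →
    wedge m d i ≈ restrict m d (head i) * wedge m (signedBy d (head i)) (tail i)
  wedge-cons m d i = begin
    (r₀ * ∏ rs) * sgn i                    ≈⟨ *-congˡ (sgn-cons i) ⟩
    (r₀ * ∏ rs) * (∏ ps * sgn (tail i))    ≈⟨ regroup r₀ (∏ rs) (∏ ps) (sgn (tail i)) ⟩
    r₀ * ((∏ rs * ∏ ps) * sgn (tail i))    ≈⟨ *-congˡ (*-congʳ (∏-distrib-* rs ps)) ⟨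
    r₀ * (∏ (λ k → rs k * ps k) * sgn (tail i)) ≈⟨ *-congˡ (*-congʳ (∏-cong λ k → sym (restrict-signedBy m d x (tail i k)))) ⟩
    r₀ * wedge m (signedBy d x) (tail i)   ∎
    where
    x = head i
    r₀ = restrict m d x
    rs ps : Fin _ → Carrier
    rs k = restrict m d (tail i k)
    ps k = pairSign x (tail i k)
    regroup : ∀ a b c d → (a * b) * (c * d) ≈ a * ((b * c) * d)
    regroup a b c d = trans (*-assoc a b (c * d)) (*-congˡ (sym (*-assoc b c d)))

  wedge-expand₁ : ∀ {n N} (m : Fin N → Bool) d (i : Vector (Fin N) (suc n)) →
    wedge m d i ≈ ∑ λ a → if m a then (δ (head i) a * d a) * wedge (remove a m) (signedBy d a) (tail i) else 0#
  wedge-expand₁ m d i = begin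
    wedge m d i                                         ≈⟨ wedge-cons m d i ⟩
    restrict m d x * wedge m (signedBy d x) (tail i)    ≈⟨ minor x ⟨
    G x                                                 ≈⟨ ∑-δ x G ⟨
    ∑ (λ a → δ x a * G a)                               ≈⟨ ∑-cong pull-δ ⟨
    _                                                   ∎
    where
    x = head i
    G : _ → Carrier
    G a = if m a then d a * wedge (remove a m) (signedBy d a) (tail i) else 0#
    pull-δ : ∀ a → (if m a then (δ x a * d a) * wedge (remove a m) (signedBy d a) (tail i) else 0#) ≈ δ x a * G a
    pull-δ a with m a
    ... | true  = *-assoc _ _ _
    ... | false = sym (zeroʳ _)
    minor : ∀ a → G a ≈ restrict m d a * wedge m (signedBy d a) (tail i)
    minor a with m a
    ... | true  = *-congˡ (wedge-cong {m = remove a m} {m} {signedBy d a} {signedBy d a} (restrict-remove-signedBy a m d) (tail i))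
    ... | false = sym (zeroˡ _)

  WedgeRankLE : ℕ → ℕ → Set (c ⊔ ℓ)
  WedgeRankLE n r = ∀ {N} (m : Fin N → Bool) d → count m ≡ n → RankLE (wedge {n} m d) r

  wedgeRankLE-0 : WedgeRankLE 0 1
  wedgeRankLE-0 m d _ = (λ _ ()) , λ _ → trans (*-identityˡ _) (trans (*-identityˡ _) (sym (+-identityʳ _)))

  laplace₁ : ∀ {n r} → WedgeRankLE n r → WedgeRankLE (suc n) (suc n ℕ.* r)
  laplace₁ {n} {r} rk m d count≡ = ≡.subst (RankLE _) rank≡
    (RankLE-cong (λ i → sym (wedge-expand₁ m d i))
      (RankLE-∑ λ a → RankLE-if (m a) λ a∈m →
        RankLE-⊗ (λ v → δ v a * d a) (rk (remove a m) (signedBy d a) (count-remove-member a m a∈m count≡))))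
    where
    rank≡ : sumIncreasing 1 m r ≡ suc n ℕ.* r
    rank≡ = ≡.trans (sumIncreasing≡C 1 m r) (≡.cong (ℕ._* r) (≡.trans (≡.cong (_C 1) count≡) (nC1≡n (suc n))))

  det₃ : (X Y Z : Vector Carrier 3) → Carrier
  det₃ X Y Z = X 0F * Y 1F * Z 2F - X 0F * Y 2F * Z 1F - X 1F * Y 0F * Z 2F
             + X 1F * Y 2F * Z 0F + X 2F * Y 0F * Z 1F - X 2F * Y 1F * Z 0F

  det₃-form₁ det₃-form₂ det₃-form₃ : Fin 5 → Vector Carrier 3 → Carrier
  det₃-form₁ 0F X = X 0F
  det₃-form₁ 1F X = X 1F
  det₃-form₁ 2F X = X 2F
  det₃-form₁ 3F X = - (X 0F + X 1F + X 2F)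
  det₃-form₁ 4F X = X 1F + X 2F
  det₃-form₂ 0F Y = Y 1F
  det₃-form₂ 1F Y = Y 0F
  det₃-form₂ 2F Y = Y 0F + Y 1F + Y 2F
  det₃-form₂ 3F Y = Y 2F
  det₃-form₂ 4F Y = Y 0F + Y 2F
  det₃-form₃ 0F Z = Z 2F
  det₃-form₃ 1F Z = - (Z 0F + Z 1F + Z 2F)
  det₃-form₃ 2F Z = - Z 0F
  det₃-form₃ 3F Z = Z 1F
  det₃-form₃ 4F Z = Z 0F + Z 1F

  det₃-rank5 : ∀ X Y Z → det₃ X Y Z ≈ ∑ λ t → det₃-form₁ t X * (det₃-form₂ t Y * det₃-form₃ t Z)
  det₃-rank5 X Y Z = trans (identity (X 0F) (X 1F) (X 2F) (Y 0F) (Y 1F) (Y 2F) (Z 0F) (Z 1F) (Z 2F))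
    (+-congˡ (+-congˡ (+-congˡ (+-congˡ (sym (+-identityʳ _))))))
    where
    identity : ∀ x₀ x₁ x₂ y₀ y₁ y₂ z₀ z₁ z₂ →
      x₀ * y₁ * z₂ - x₀ * y₂ * z₁ - x₁ * y₀ * z₂ + x₁ * y₂ * z₀ + x₂ * y₀ * z₁ - x₂ * y₁ * z₀
      ≈ x₀ * (y₁ * z₂) + (x₁ * (y₀ * - (z₀ + z₁ + z₂)) + (x₂ * ((y₀ + y₁ + y₂) * - z₀)
        + (- (x₀ + x₁ + x₂) * (y₂ * z₁) + (x₁ + x₂) * ((y₀ + y₂) * (z₀ + z₁)))))
    identity = solve 9 (λ x₀ x₁ x₂ y₀ y₁ y₂ z₀ z₁ z₂ →
      x₀ :* y₁ :* z₂ :- x₀ :* y₂ :* z₁ :- x₁ :* y₀ :* z₂ :+ x₁ :* y₂ :* z₀ :+ x₂ :* y₀ :* z₁ :- x₂ :* y₁ :* z₀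
      := x₀ :* (y₁ :* z₂) :+ (x₁ :* (y₀ :* :- (z₀ :+ z₁ :+ z₂)) :+ (x₂ :* ((y₀ :+ y₁ :+ y₂) :* :- z₀)
        :+ (:- (x₀ :+ x₁ :+ x₂) :* (y₂ :* z₁) :+ (x₁ :+ x₂) :* ((y₀ :+ y₂) :* (z₀ :+ z₁)))))) ≈-refl

  ∑₃ : ∀ {N} → (Fin N → Fin N → Fin N → Carrier) → Carrier
  ∑₃ f = ∑ λ a → ∑ λ b → ∑ λ c → f a b c

  ∑₃-cong : ∀ {N} {f g : Fin N → Fin N → Fin N → Carrier} → (∀ a b c → f a b c ≈ g a b c) → ∑₃ f ≈ ∑₃ g
  ∑₃-cong f≈g = ∑-cong λ a → ∑-cong λ b → ∑-cong λ c → f≈g a b c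

  ∑₃-distrib-+ : ∀ {N} (f g : Fin N → Fin N → Fin N → Carrier) → ∑₃ (λ a b c → f a b c + g a b c) ≈ ∑₃ f + ∑₃ g
  ∑₃-distrib-+ f g = trans (∑-cong λ a → trans (∑-cong λ b → ∑-distrib-+ (f a b) (g a b))
                                                (∑-distrib-+ (λ b → ∑ (f a b)) (λ b → ∑ (g a b))))
                           (∑-distrib-+ (λ a → ∑ λ b → ∑ (f a b)) (λ a → ∑ λ b → ∑ (g a b)))

  ∑₃-distrib-- : ∀ {N} (f : Fin N → Fin N → Fin N → Carrier) → ∑₃ (λ a b c → - f a b c) ≈ - ∑₃ f
  ∑₃-distrib-- f = trans (∑-cong λ a → trans (∑-cong λ b → ∑-distrib-- (f a b)) (∑-distrib-- λ b → ∑ (f a b)))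
                         (∑-distrib-- λ a → ∑ λ b → ∑ (f a b))

  ∑₃-δ : ∀ {N} (p q s : Fin N) (H : Fin N → Fin N → Fin N → Carrier) →
    ∑₃ (λ a b c → δ p a * (δ q b * (δ s c * H a b c))) ≈ H p q s
  ∑₃-δ p q s H = begin
    ∑₃ (λ a b c → δ p a * (δ q b * (δ s c * H a b c)))
      ≈⟨ ∑-cong (λ a → ∑-cong λ b → pull a b) ⟩
    ∑ (λ a → ∑ λ b → δ p a * (δ q b * ∑ λ c → δ s c * H a b c))
      ≈⟨ ∑-cong (λ a → ∑-cong λ b → *-congˡ (*-congˡ (∑-δ s (H a b)))) ⟩
    ∑ (λ a → ∑ λ b → δ p a * (δ q b * H a b s))
      ≈⟨ ∑-cong (λ a → *-distribˡ-∑ (δ p a) λ b → δ q b * H a b s) ⟨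
    ∑ (λ a → δ p a * ∑ λ b → δ q b * H a b s)
      ≈⟨ ∑-cong (λ a → *-congˡ (∑-δ q λ b → H a b s)) ⟩
    ∑ (λ a → δ p a * H a q s)
      ≈⟨ ∑-δ p (λ a → H a q s) ⟩
    H p q s ∎
    where
    pull : ∀ a b → ∑ (λ c → δ p a * (δ q b * (δ s c * H a b c))) ≈ δ p a * (δ q b * ∑ λ c → δ s c * H a b c)
    pull a b = sym (trans (*-congˡ (*-distribˡ-∑ (δ q b) λ c → δ s c * H a b c)) (*-distribˡ-∑ (δ p a) λ c → δ q b * (δ s c * H a b c)))

  antisymmetrize : ∀ {A : Set} → (A → A → A → Carrier) → A → A → A → Carrier
  antisymmetrize H x y z = H x y z - H x z y - H y x z + H z x y + H y z x - H z y x

  antisymmetrize-cong : ∀ {A : Set} {G G′ : A → A → A → Carrier} x y z →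
    G x y z ≈ G′ x y z → G x z y ≈ G′ x z y → G y x z ≈ G′ y x z →
    G z x y ≈ G′ z x y → G y z x ≈ G′ y z x → G z y x ≈ G′ z y x →
    antisymmetrize G x y z ≈ antisymmetrize G′ x y z
  antisymmetrize-cong x y z ≈xyz ≈xzy ≈yxz ≈zxy ≈yzx ≈zyx =
    +-cong (+-cong (+-cong (+-cong (+-cong ≈xyz (-‿cong ≈xzy)) (-‿cong ≈yxz)) ≈zxy) ≈yzx) (-‿cong ≈zyx)

  δ-row : ∀ {N} → Fin N → Fin N → Fin N → Fin N → Vector Carrier 3
  δ-row x a b c = δ x a ∷ δ x b ∷ δ x c ∷ []

  ∑₃-det₃-δ : ∀ {N} (x y z : Fin N) (H : Fin N → Fin N → Fin N → Carrier) →
    ∑₃ (λ a b c → det₃ (δ-row x a b c) (δ-row y a b c) (δ-row z a b c) * H a b c) ≈ antisymmetrize H x y z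
  ∑₃-det₃-δ x y z H = begin
    ∑₃ (λ a b c → det₃ (δ-row x a b c) (δ-row y a b c) (δ-row z a b c) * H a b c)
      ≈⟨ ∑₃-cong (λ a b c → expand (δ x a) (δ x b) (δ x c) (δ y a) (δ y b) (δ y c) (δ z a) (δ z b) (δ z c) (H a b c)) ⟩
    ∑₃ (λ a b c → τ x y z a b c - τ x z y a b c - τ y x z a b c + τ z x y a b c + τ y z x a b c - τ z y x a b c)
      ≈⟨ linear (τ x y z) (τ x z y) (τ y x z) (τ z x y) (τ y z x) (τ z y x) ⟩
    antisymmetrize (λ p q s → ∑₃ (τ p q s)) x y z
      ≈⟨ antisymmetrize-cong {G = λ p q s → ∑₃ (τ p q s)} {H} x y z
           (∑₃-δ x y z H) (∑₃-δ x z y H) (∑₃-δ y x z H) (∑₃-δ z x y H) (∑₃-δ y z x H) (∑₃-δ z y x H) ⟩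
    antisymmetrize H x y z ∎
    where
    τ : _ → _ → _ → _ → _ → _ → Carrier
    τ p q s a b c = δ p a * (δ q b * (δ s c * H a b c))
    ∑₃-sub : ∀ f g → ∑₃ (λ a b c → f a b c - g a b c) ≈ ∑₃ f - ∑₃ g
    ∑₃-sub f g = trans (∑₃-distrib-+ f (λ a b c → - g a b c)) (+-congˡ (∑₃-distrib-- g))
    linear : ∀ f₁ f₂ f₃ f₄ f₅ f₆ →
      ∑₃ (λ a b c → f₁ a b c - f₂ a b c - f₃ a b c + f₄ a b c + f₅ a b c - f₆ a b c)
      ≈ ∑₃ f₁ - ∑₃ f₂ - ∑₃ f₃ + ∑₃ f₄ + ∑₃ f₅ - ∑₃ f₆
    linear f₁ f₂ f₃ f₄ f₅ f₆ =
      trans (∑₃-sub _ f₆) (+-congʳ (trans (∑₃-distrib-+ _ f₅) (+-congʳ (trans (∑₃-distrib-+ _ f₄)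
        (+-congʳ (trans (∑₃-sub _ f₃) (+-congʳ (∑₃-sub f₁ f₂))))))))
    expand : ∀ x₀ x₁ x₂ y₀ y₁ y₂ z₀ z₁ z₂ h →
      (x₀ * y₁ * z₂ - x₀ * y₂ * z₁ - x₁ * y₀ * z₂ + x₁ * y₂ * z₀ + x₂ * y₀ * z₁ - x₂ * y₁ * z₀) * h
      ≈ x₀ * (y₁ * (z₂ * h)) - x₀ * (z₁ * (y₂ * h)) - y₀ * (x₁ * (z₂ * h))
        + z₀ * (x₁ * (y₂ * h)) + y₀ * (z₁ * (x₂ * h)) - z₀ * (y₁ * (x₂ * h))
    expand = solve 10 (λ x₀ x₁ x₂ y₀ y₁ y₂ z₀ z₁ z₂ h →
      (x₀ :* y₁ :* z₂ :- x₀ :* y₂ :* z₁ :- x₁ :* y₀ :* z₂ :+ x₁ :* y₂ :* z₀ :+ x₂ :* y₀ :* z₁ :- x₂ :* y₁ :* z₀) :* h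
      := x₀ :* (y₁ :* (z₂ :* h)) :- x₀ :* (z₁ :* (y₂ :* h)) :- y₀ :* (x₁ :* (z₂ :* h))
        :+ z₀ :* (x₁ :* (y₂ :* h)) :+ y₀ :* (z₁ :* (x₂ :* h)) :- z₀ :* (y₁ :* (x₂ :* h))) ≈-refl

  lt : ℕ → ℕ → Carrier
  lt X Y = 𝟙 (X <ᵇ Y)

  pairSign≈lt-lt : ∀ {N} (x v : Fin N) → pairSign x v ≈ lt (toℕ x) (toℕ v) - lt (toℕ v) (toℕ x)
  pairSign≈lt-lt x v = go (toℕ x) (toℕ v)
    where
    go : ∀ X V → 𝟙 ((if X ≡ᵇ V then 1 else 0) ≡ᵇ 0) * signK (if V <ᵇ X then 1 else 0) ≈ lt X V - lt V X
    go zero    zero    = trans (zeroˡ _) (sym (-‿inverseʳ 0#))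
    go zero    (suc V) = trans (*-identityˡ _) (sym (trans (+-congˡ -0#≈0#) (+-identityʳ _)))
    go (suc X) zero    = trans (*-identityˡ _) (sym (+-identityˡ _))
    go (suc X) (suc V) = go X V

  lt-cyclic : ∀ X Y Z → lt X Y * (lt Y Z * lt Z X) ≈ 0#
  lt-cyclic zero    Y       Z       = trans (*-congˡ (zeroʳ _)) (zeroʳ _)
  lt-cyclic (suc X) zero    Z       = zeroˡ _
  lt-cyclic (suc X) (suc Y) zero    = trans (*-congˡ (zeroˡ _)) (zeroʳ _)
  lt-cyclic (suc X) (suc Y) (suc Z) = lt-cyclic X Y Z

  ordered : ℕ → ℕ → ℕ → Carrier
  ordered X Y Z = lt X Y * (lt Y Z * lt X Z)

  -- The two products of the expansion that are missing on the right are cyclic orders, hence 0.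
  pairSigns≈antisymmetrize-ordered : ∀ X Y Z →
    (lt X Y - lt Y X) * ((lt X Z - lt Z X) * (lt Y Z - lt Z Y)) ≈ antisymmetrize ordered X Y Z
  pairSigns≈antisymmetrize-ordered X Y Z = begin
    (lt X Y - lt Y X) * ((lt X Z - lt Z X) * (lt Y Z - lt Z Y))
      ≈⟨ expand (lt X Y) (lt Y X) (lt X Z) (lt Z X) (lt Y Z) (lt Z Y) ⟩
    antisymmetrize ordered X Y Z + (- (lt X Y * (lt Y Z * lt Z X)) + lt Y X * (lt X Z * lt Z Y))
      ≈⟨ +-congˡ (+-cong (trans (-‿cong (lt-cyclic X Y Z)) -0#≈0#) (lt-cyclic Y X Z)) ⟩
    antisymmetrize ordered X Y Z + (0# + 0#)
      ≈⟨ trans (+-congˡ (+-identityʳ 0#)) (+-identityʳ _) ⟩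
    antisymmetrize ordered X Y Z ∎
    where
    expand : ∀ xy yx xz zx yz zy →
      (xy - yx) * ((xz - zx) * (yz - zy))
      ≈ xy * (yz * xz) - xz * (zy * xy) - yx * (xz * yz) + zx * (xy * zy) + yz * (zx * yx) - zy * (yx * zx)
        + (- (xy * (yz * zx)) + yx * (xz * zy))
    expand = solve 6 (λ xy yx xz zx yz zy →
      (xy :- yx) :* ((xz :- zx) :* (yz :- zy))
      := xy :* (yz :* xz) :- xz :* (zy :* xy) :- yx :* (xz :* yz) :+ zx :* (xy :* zy) :+ yz :* (zx :* yx) :- zy :* (yx :* zx)
        :+ (:- (xy :* (yz :* zx)) :+ yx :* (xz :* zy))) ≈-refl

  ∑<₃ : ∀ {N} → (Fin N → Bool) → (Fin N → Fin N → Fin N → Carrier) → Carrier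
  ∑<₃ m f = ∑ λ a → if m a then (∑ λ b → if above a m b then
              (∑ λ c → if above b (above a m) c then f a b c else 0#) else 0#) else 0#

  ∑<₃≈∑₃ : ∀ {N} (m : Fin N → Bool) f →
    ∑<₃ m f ≈ ∑₃ λ a b c → 𝟙 (m a) * (𝟙 (above a m b) * (𝟙 (above b (above a m) c) * f a b c))
  ∑<₃≈∑₃ m f = ∑-cong λ a →
    trans (if≈𝟙* (m a) _) (trans (*-distribˡ-∑ (𝟙 (m a)) (middle a)) (∑-cong λ b →
    trans (*-congˡ (trans (if≈𝟙* (above a m b) _) (*-distribˡ-∑ (𝟙 (above a m b)) (inner a b))))
    (trans (*-distribˡ-∑ (𝟙 (m a)) λ c → 𝟙 (above a m b) * inner a b c)
    (∑-cong λ c → *-congˡ (*-congˡ (if≈𝟙* (above b (above a m) c) (f a b c)))))))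
    where
    inner : _ → _ → _ → Carrier
    inner a b c = if above b (above a m) c then f a b c else 0#
    middle : _ → _ → Carrier
    middle a b = if above a m b then ∑ (inner a b) else 0#

  ∑<₃-cong : ∀ {N} (m : Fin N → Bool) {f g : Fin N → Fin N → Fin N → Carrier} →
    (∀ a b c → f a b c ≈ g a b c) → ∑<₃ m f ≈ ∑<₃ m g
  ∑<₃-cong m f≈g = ∑-cong λ a → if-cong (m a) (∑-cong λ b → if-cong (above a m b) (∑-cong λ c →
    if-cong (above b (above a m) c) (f≈g a b c)))
    where
    if-cong : ∀ b {x y} → x ≈ y → (if b then x else 0#) ≈ (if b then y else 0#)
    if-cong true  x≈y = x≈y
    if-cong false x≈y = ≈-refl

  RankLE-∑<₃ : ∀ {n N} (m : Fin N → Bool) {T : Fin N → Fin N → Fin N → Vector (Fin N) n → Carrier} {r} →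
    (∀ a b c → m a ≡ true → above a m b ≡ true → above b (above a m) c ≡ true → RankLE (T a b c) r) →
    RankLE (λ i → ∑<₃ m λ a b c → T a b c i) (sumIncreasing 3 m r)
  RankLE-∑<₃ m rk =
    RankLE-∑ λ a → RankLE-if (m a) λ a∈ →
    RankLE-∑ λ b → RankLE-if (above a m b) λ b∈ →
    RankLE-∑ λ c → RankLE-if (above b (above a m) c) λ c∈ → rk a b c a∈ b∈ c∈

  signedBy₃ : ∀ {N} → (Fin N → Carrier) → Fin N → Fin N → Fin N → Fin N → Carrier
  signedBy₃ d a b c = signedBy (signedBy (signedBy d a) b) c

  signedBy₃-swap₁₂ : ∀ {N} (d : Fin N → Carrier) a b c v → signedBy₃ d a b c v ≈ signedBy₃ d b a c v
  signedBy₃-swap₁₂ d a b c v = *-congʳ (xy*z≈xz*y (d v) (pairSign a v) (pairSign b v))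

  signedBy₃-swap₂₃ : ∀ {N} (d : Fin N → Carrier) a b c v → signedBy₃ d a b c v ≈ signedBy₃ d a c b v
  signedBy₃-swap₂₃ d a b c v = xy*z≈xz*y (signedBy d a v) (pairSign b v) (pairSign c v)

  wedge-remove₃ : ∀ {n N} (a b c : Fin N) m d (r : Vector (Fin N) n) →
    wedge (remove₃ a b c m) (signedBy₃ d a b c) r ≈ wedge m (signedBy₃ d a b c) r
  wedge-remove₃ a b c m d = wedge-cong {m = remove₃ a b c m} {m} {e} {e} λ v →
    trans (restrict-remove c (remove b (remove a m)) e (signedBy-self d₂ c) v)
    (trans (restrict-remove b (remove a m) e (signedBy-vanishes d₂ c (signedBy-self d₁ b)) v)
           (restrict-remove a m e (signedBy-vanishes d₂ c (signedBy-vanishes d₁ b (signedBy-self d a))) v))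
    where
    d₁ = signedBy d a
    d₂ = signedBy d₁ b
    e = signedBy d₂ c

  module ThreeRows {n N : ℕ} (m : Fin N → Bool) (d : Fin N → Carrier) where

    e : Fin N → Carrier
    e v = 𝟙 (m v) * d v

    minor : Fin N → Fin N → Fin N → Vector (Fin N) n → Carrier
    minor a b c = wedge (remove₃ a b c m) (signedBy₃ d a b c)

    summand : Vector (Fin N) n → Fin N → Fin N → Fin N → Carrier
    summand r p q s = 𝟙 (m p) * (𝟙 (above p m q) * (𝟙 (above q (above p m) s) * ((d p * d q * d s) * minor p q s r)))

    summand≈ordered : ∀ (x y z : Fin N) r p q s → (∀ v → signedBy₃ d p q s v ≈ signedBy₃ d x y z v) →
      summand r p q s ≈ ordered (toℕ p) (toℕ q) (toℕ s) * ((e p * e q * e s) * wedge m (signedBy₃ d x y z) r)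
    summand≈ordered x y z r p q s perm = trans
      (*-congˡ (*-cong (𝟙-∧ (toℕ p <ᵇ toℕ q) (m q)) (*-cong (trans (𝟙-∧ (toℕ q <ᵇ toℕ s) (above p m s))
        (*-congˡ (𝟙-∧ (toℕ p <ᵇ toℕ s) (m s)))) (*-congˡ minor≈))))
      (regroup (𝟙 (m p)) (𝟙 (m q)) (𝟙 (m s)) (lt (toℕ p) (toℕ q)) (lt (toℕ q) (toℕ s)) (lt (toℕ p) (toℕ s))
               (d p) (d q) (d s) (wedge m (signedBy₃ d x y z) r))
      where
      minor≈ : minor p q s r ≈ wedge m (signedBy₃ d x y z) r
      minor≈ = trans (wedge-remove₃ p q s m d r) (wedge-cong {m = m} {m} {signedBy₃ d p q s} {signedBy₃ d x y z} (λ v → restrict-cong (perm v)) r)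
        where
        restrict-cong : ∀ {v d′} → signedBy₃ d p q s v ≈ d′ → restrict m (signedBy₃ d p q s) v ≈ (if m v then d′ else 0#)
        restrict-cong {v} eq with m v
        ... | true  = eq
        ... | false = ≈-refl
      regroup : ∀ ip iq is lpq lqs lps dp dq ds w →
        ip * ((lpq * iq) * ((lqs * (lps * is)) * ((dp * dq * ds) * w)))
        ≈ (lpq * (lqs * lps)) * (((ip * dp) * (iq * dq) * (is * ds)) * w)
      regroup = solve 10 (λ ip iq is lpq lqs lps dp dq ds w →
        ip :* ((lpq :* iq) :* ((lqs :* (lps :* is)) :* ((dp :* dq :* ds) :* w)))
        := (lpq :* (lqs :* lps)) :* (((ip :* dp) :* (iq :* dq) :* (is :* ds)) :* w)) ≈-refl

    antisymmetrize-summand : ∀ (x y z : Fin N) r →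
      antisymmetrize (summand r) x y z ≈ antisymmetrize ordered (toℕ x) (toℕ y) (toℕ z) * ((e x * e y * e z) * wedge m (signedBy₃ d x y z) r)
    antisymmetrize-summand x y z r = trans
      (antisymmetrize-cong {G = summand r} {λ p q s → ordered (toℕ p) (toℕ q) (toℕ s) * ((e p * e q * e s) * W)} x y z
        (summand≈ordered x y z r x y z λ _ → ≈-refl)
        (summand≈ordered x y z r x z y (swap₂₃ x z y))
        (summand≈ordered x y z r y x z (swap₁₂ y x z))
        (summand≈ordered x y z r z x y λ v → trans (swap₁₂ z x y v) (swap₂₃ x z y v))
        (summand≈ordered x y z r y z x λ v → trans (swap₂₃ y z x v) (swap₁₂ y x z v))
        (summand≈ordered x y z r z y x λ v → trans (swap₁₂ z y x v) (trans (swap₂₃ y z x v) (swap₁₂ y x z v))))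
      (collect (ordered X Y Z) (ordered X Z Y) (ordered Y X Z) (ordered Z X Y) (ordered Y Z X) (ordered Z Y X) (e x) (e y) (e z) W)
      where
      X = toℕ x
      Y = toℕ y
      Z = toℕ z
      W = wedge m (signedBy₃ d x y z) r
      swap₁₂ = signedBy₃-swap₁₂ d
      swap₂₃ = signedBy₃-swap₂₃ d
      collect : ∀ o₁ o₂ o₃ o₄ o₅ o₆ ex ey ez w →
        o₁ * ((ex * ey * ez) * w) - o₂ * ((ex * ez * ey) * w) - o₃ * ((ey * ex * ez) * w)
        + o₄ * ((ez * ex * ey) * w) + o₅ * ((ey * ez * ex) * w) - o₆ * ((ez * ey * ex) * w)
        ≈ (o₁ - o₂ - o₃ + o₄ + o₅ - o₆) * ((ex * ey * ez) * w)
      collect = solve 10 (λ o₁ o₂ o₃ o₄ o₅ o₆ ex ey ez w →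
        o₁ :* ((ex :* ey :* ez) :* w) :- o₂ :* ((ex :* ez :* ey) :* w) :- o₃ :* ((ey :* ex :* ez) :* w)
        :+ o₄ :* ((ez :* ex :* ey) :* w) :+ o₅ :* ((ey :* ez :* ex) :* w) :- o₆ :* ((ez :* ey :* ex) :* w)
        := (o₁ :- o₂ :- o₃ :+ o₄ :+ o₅ :- o₆) :* ((ex :* ey :* ez) :* w)) ≈-refl

    wedge-expand₃ : ∀ (i : Vector (Fin N) (3 ℕ.+ n)) → wedge m d i ≈ ∑<₃ m λ a b c →
      ((d a * d b * d c) * det₃ (δ-row (i 0F) a b c) (δ-row (i 1F) a b c) (δ-row (i 2F) a b c)) * minor a b c (tail (tail (tail i)))
    wedge-expand₃ i = begin
      wedge m d i
        ≈⟨ trans (wedge-cons m d i) (*-congˡ (trans (wedge-cons m d₁ (tail i)) (*-congˡ (wedge-cons m d₂ (tail (tail i)))))) ⟩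
      restrict m d x * (restrict m d₁ y * (restrict m d₂ z * W))
        ≈⟨ *-cong (if≈𝟙* (m x) (d x)) (*-cong (trans (restrict-signedBy m d x y) (*-congʳ (if≈𝟙* (m y) (d y))))
             (*-congʳ (trans (restrict-signedBy m d₁ y z) (*-congʳ (trans (restrict-signedBy m d x z) (*-congʳ (if≈𝟙* (m z) (d z)))))))) ⟩
      e x * ((e y * pairSign x y) * (((e z * pairSign x z) * pairSign y z) * W))
        ≈⟨ regroup (e x) (e y) (e z) (pairSign x y) (pairSign x z) (pairSign y z) W ⟩
      (pairSign x y * (pairSign x z * pairSign y z)) * ((e x * e y * e z) * W)
        ≈⟨ *-congʳ (trans (*-cong (pairSign≈lt-lt x y) (*-cong (pairSign≈lt-lt x z) (pairSign≈lt-lt y z)))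
                          (pairSigns≈antisymmetrize-ordered (toℕ x) (toℕ y) (toℕ z))) ⟩
      antisymmetrize ordered (toℕ x) (toℕ y) (toℕ z) * ((e x * e y * e z) * W)
        ≈⟨ antisymmetrize-summand x y z r ⟨
      antisymmetrize (summand r) x y z
        ≈⟨ ∑₃-det₃-δ x y z (summand r) ⟨
      ∑₃ (λ a b c → det₃ (δ-row x a b c) (δ-row y a b c) (δ-row z a b c) * summand r a b c)
        ≈⟨ ∑₃-cong (λ a b c → pull-in (det₃ (δ-row x a b c) (δ-row y a b c) (δ-row z a b c))
                                       (𝟙 (m a)) (𝟙 (above a m b)) (𝟙 (above b (above a m) c)) (d a * d b * d c) (minor a b c r)) ⟩
      _ ≈⟨ ∑<₃≈∑₃ m _ ⟨
      _ ∎
      where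
      x = i 0F
      y = i 1F
      z = i 2F
      r = tail (tail (tail i))
      d₁ = signedBy d x
      d₂ = signedBy d₁ y
      W = wedge m (signedBy₃ d x y z) r
      regroup : ∀ ex ey ez pxy pxz pyz w →
        ex * ((ey * pxy) * (((ez * pxz) * pyz) * w)) ≈ (pxy * (pxz * pyz)) * ((ex * ey * ez) * w)
      regroup = solve 7 (λ ex ey ez pxy pxz pyz w →
        ex :* ((ey :* pxy) :* (((ez :* pxz) :* pyz) :* w)) := (pxy :* (pxz :* pyz)) :* ((ex :* ey :* ez) :* w)) ≈-refl
      pull-in : ∀ δ₃ ia ib ic dabc w → δ₃ * (ia * (ib * (ic * (dabc * w)))) ≈ ia * (ib * (ic * ((dabc * δ₃) * w)))
      pull-in = solve 6 (λ δ₃ ia ib ic dabc w →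
        δ₃ :* (ia :* (ib :* (ic :* (dabc :* w)))) := ia :* (ib :* (ic :* ((dabc :* δ₃) :* w)))) ≈-refl

  rank5-term : ∀ D X Y Z M → (D * det₃ X Y Z) * M ≈ ∑ λ t → (D * det₃-form₁ t X) * (det₃-form₂ t Y * (det₃-form₃ t Z * M))
  rank5-term D X Y Z M = begin
    (D * det₃ X Y Z) * M                 ≈⟨ *-congʳ (*-congˡ (det₃-rank5 X Y Z)) ⟩
    (D * ∑ g) * M                         ≈⟨ *-congʳ (*-distribˡ-∑ D g) ⟩
    (∑ λ t → D * g t) * M                 ≈⟨ *-distribʳ-∑ M (λ t → D * g t) ⟩
    (∑ λ t → (D * g t) * M)               ≈⟨ ∑-cong (λ t → reassoc D (det₃-form₁ t X) (det₃-form₂ t Y) (det₃-form₃ t Z) M) ⟩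
    _                                      ∎
    where
    g : Fin 5 → Carrier
    g t = det₃-form₁ t X * (det₃-form₂ t Y * det₃-form₃ t Z)
    reassoc : ∀ D a b c M → (D * (a * (b * c))) * M ≈ (D * a) * (b * (c * M))
    reassoc = solve 5 (λ D a b c M → (D :* (a :* (b :* c))) :* M := (D :* a) :* (b :* (c :* M))) ≈-refl

  laplace₃ : ∀ {n r} → WedgeRankLE n r → WedgeRankLE (3 ℕ.+ n) (((3 ℕ.+ n) C 3) ℕ.* (5 ℕ.* r))
  laplace₃ {n} {r} rk m d count≡ = ≡.subst (RankLE _) rank≡ (RankLE-cong expansion
    (RankLE-∑<₃ m λ a b c a∈ b∈ c∈ → RankLE-∑ λ t →
      RankLE-⊗ (λ x → (d a * d b * d c) * det₃-form₁ t (δ-row x a b c))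
      (RankLE-⊗ (λ y → det₃-form₂ t (δ-row y a b c))
      (RankLE-⊗ (λ z → det₃-form₃ t (δ-row z a b c))
      (rk (remove₃ a b c m) (signedBy₃ d a b c) (count-remove₃ a b c m a∈ b∈ c∈ count≡))))))
    where
    open ThreeRows {n} m d using (minor; wedge-expand₃)
    rank≡ : sumIncreasing 3 m (5 ℕ.* r) ≡ ((3 ℕ.+ n) C 3) ℕ.* (5 ℕ.* r)
    rank≡ = ≡.trans (sumIncreasing≡C 3 m (5 ℕ.* r)) (≡.cong (λ k → (k C 3) ℕ.* (5 ℕ.* r)) count≡)
    expansion : ∀ i → _ ≈ wedge m d i
    expansion i = sym (trans (wedge-expand₃ i) (∑<₃-cong m λ a b c → rank5-term (d a * d b * d c)
      (δ-row (i 0F) a b c) (δ-row (i 1F) a b c) (δ-row (i 2F) a b c) (minor a b c (tail (tail (tail i))))))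

  wedgeRankLE : ∀ n → WedgeRankLE n (detRankBound n)
  wedgeRankLE 0                   = wedgeRankLE-0
  wedgeRankLE 1                   = laplace₁ wedgeRankLE-0
  wedgeRankLE 2                   = laplace₁ (wedgeRankLE 1)
  wedgeRankLE (suc (suc (suc n))) = laplace₃ (wedgeRankLE n)

  det≈wedge : ∀ n i → det n i ≈ wedge (λ _ → true) (λ _ → 1#) i
  det≈wedge n i = trans det≈sgn (trans (sym (*-identityˡ _)) (*-congʳ (sym (∏-1 n))))
    where
    det≈sgn : det n i ≈ sgn i
    det≈sgn with collisions i ≡ᵇ 0
    ... | true  = sym (*-identityˡ _)
    ... | false = sym (zeroˡ _)

  trkLE-det : ∀ n → TrkLE (det n) (detRankBound n)
  trkLE-det n = RankLE-cong (λ i → sym (det≈wedge n i)) (wedgeRankLE n (λ _ → true) (λ _ → 1#) (count-all n))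

TrkLE⇒BrkLE : ∀ {c ℓ} (F : Field c ℓ) {n} {T : Tensors.Tensor F n} {r} → Tensors.TrkLE F T r → Tensors.BrkLE F T r
TrkLE⇒BrkLE F {T = T} trk p vanishes = vanishes T trk

open import Data.Nat using (_≤_; _*_; _^_; _/_; _!)

corollary1p4 : ∀ {c ℓ} (F : Field c ℓ) (n : ℕ) → 1 ≤ n →
    (∀ r → Tensors.TrkLE F (Tensors.det F n) r → Tensors.BrkLE F (Tensors.det F n) r)
    × Σ ℕ (λ r → Tensors.TrkLE F (Tensors.det F n) r × 6 ^ (n / 3) * r ≤ 5 ^ (n / 3) * n !)
corollary1p4 F n _ = (λ r → TrkLE⇒BrkLE F) , detRankBound n , Wedge.trkLE-det F n , 6^[n/3]*detRankBound≤5^[n/3]*n! n
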